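{- Let $h\geq 3$ and $k\geq 3h+3$ be positive integers, and let $A=[0,k+1]\setminus\{x,x+1\}$ with $x\in[1,k-1]$. (i) If $x\in[1,h-1]$, then $|h^{\wedge}A| = hk-h^2+2x+1$. (ii) If $x\in[k-h+1,k-1]$, then $|h^{\wedge}A| = (h+2)k-h^2-2x+1$. (iii) If $x\in\{h,k-h\}$, then $|h^{\wedge}A| = hk-h^2+2h-1$. (iv) If $x\in[h+1,k-h-1]$, then $|h^{\wedge}A| = hk-h^2+2h+1$.
   Context: For a finite set $A$ of integers and a positive integer $h\le |A|$, the restricted $h$-fold sumset $h^{\wedge}A$ is the set of all sums of $h$ distinct elements of $A$. For integers $\alpha\le\beta$, $[\alpha,\beta]=\{x\in\mathbb{Z}:\alpha\le x\le\beta\}$. -}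

module Defs where

open import Data.Nat using (ℕ)
open import Data.Integer using (ℤ; +_; _+_; _≤_)
open import Data.List using (List; []; _∷_; length; foldr)
open import Data.List.Relation.Unary.All using (All)
open import Data.List.Relation.Unary.Unique.Propositional using (Unique)
open import Data.List.Membership.Propositional using (_∈_)
open import Data.Product using (Σ; _×_)
open import Function.Bundles using (_⇔_)
open import Relation.Binary.PropositionalEquality using (_≡_; _≢_)

sumℤ : List ℤ → ℤ
sumℤ = foldr _+_ (+ 0)

RestrictedSumset : ℕ → (ℤ → Set) → ℤ → Set
RestrictedSumset h A s =
  Σ (List ℤ) λ L → Unique L × length L ≡ h × All A L × sumℤ L ≡ s

HasCard : (ℤ → Set) → ℕ → Set
HasCard P n = Σ (List ℤ) λ S → Unique S × length S ≡ n × (∀ s → (s ∈ S) ⇔ P s)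

A : ℕ → ℤ → ℤ → Set
A k x a = (+ 0 ≤ a) × (a ≤ + k + + 1) × (a ≢ x) × (a ≢ x + + 1)

-- Write A = L ∪ U with L = [0, x-1] and U = [x+2, k+1].  The sums of m distinct elements
-- of an interval [a, b] are exactly the integers of [T m + m a, T m + m (b + 1 - m)], where
-- T m = m (m - 1) / 2.  Hence the sums of h distinct elements of A, t of them taken from U,
-- fill an interval J t, and h^A is the union of J t over the admissible t.  Both ends of
-- J t increase with t, and J t, J (t + 1) overlap or touch unless u v + t w < 2, where
-- u = h - t - 1 and v, w are the slacks in h - t ≤ x and t + 1 ≤ k - x.  As k ≥ 3h + 3,
-- this happens only for x = h, between J 0 = {T h} and J 1, and for x = k - h, between
-- J (h - 1) and the point J h; each time exactly two sums are missed.  The cardinality is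
-- then read off from the two ends of the chain.
module Submission where

open import Defs
open import Data.Nat as ℕ using (ℕ; zero; suc; z≤n; s≤s; _≤′_; ≤′-refl; ≤′-step)
import Data.Nat.Properties as ℕP
open import Data.Nat.Tactic.RingSolver renaming (solve-∀ to ℕ-solve-∀)
open import Data.Integer using (ℤ; +_; -[1+_]; 0ℤ; _+_; _-_; _*_; -_; ∣_∣; _≤_; _<_; +≤+; +<+)
import Data.Integer.Properties as ℤP
open import Data.Integer.Tactic.RingSolver using (solve-∀)
open import Data.Product using (Σ; _×_; _,_; proj₁; proj₂)
open import Data.Sum using (_⊎_; inj₁; inj₂; [_,_]′; swap)
open import Data.Sum.Function.Propositional using (_⊎-⇔_)
open import Data.List using ([]; _∷_; length; map; _++_; filter; applyUpTo)
open import Data.List.Properties using (length-map; length-++; length-applyUpTo)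
open import Data.List.Relation.Unary.All as All using (All; []; _∷_)
import Data.List.Relation.Unary.All.Properties as AllP
open import Data.List.Relation.Unary.Any using (here; there; _─_)
open import Data.List.Relation.Unary.AllPairs using ([]; _∷_)
open import Data.List.Relation.Unary.Unique.Propositional using (Unique)
import Data.List.Relation.Unary.Unique.Propositional.Properties as UniqueP
open import Data.List.Membership.Propositional using (_∈_)
open import Data.List.Membership.Propositional.Properties using (∈-applyUpTo⁺; ∈-applyUpTo⁻)
open import Data.List.Membership.DecPropositional ℤP._≟_ using (_∈?_)
open import Data.Empty using (⊥-elim)
open import Function using (_∘_)
open import Function.Bundles using (_⇔_; mk⇔; Equivalence)
import Function.Properties.Equivalence as ⇔
open import Relation.Nullary using (¬_; yes; no; _×-dec_)
open import Relation.Unary using (Decidable)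
open import Relation.Unary.Properties using (∁?)
open import Relation.Binary.PropositionalEquality
open ℤP.≤-Reasoning

i+j-j≡i : ∀ i j → i + j - j ≡ i
i+j-j≡i = solve-∀

i+j-i≡j : ∀ i j → i + j - i ≡ j
i+j-i≡j = solve-∀

i-j+j≡i : ∀ i j → i - j + j ≡ i
i-j+j≡i = solve-∀

i+[j-i]≡j : ∀ i j → i + (j - i) ≡ j
i+[j-i]≡j = solve-∀

i-[i-j]≡j : ∀ i j → i - (i - j) ≡ j
i-[i-j]≡j = solve-∀

j≡i+n⇒i≤j : ∀ {i j : ℤ} (n : ℕ) → j ≡ i + + n → i ≤ j
j≡i+n⇒i≤j {i} n refl = ℤP.i≤i+j i (+ n)

j≡i+1+n⇒i<j : ∀ {i j : ℤ} (n : ℕ) → j ≡ i + + suc n → i < j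
j≡i+1+n⇒i<j {i} n refl = ℤP.suc[i]≤j⇒i<j (j≡i+n⇒i≤j n (shuffle i (+ n)))
  where
  shuffle : ∀ i n → i + (+ 1 + n) ≡ + 1 + i + n
  shuffle = solve-∀

i≤j⇒∃[n]j≡i+n : ∀ {i j : ℤ} → i ≤ j → Σ ℕ λ n → j ≡ i + + n
i≤j⇒∃[n]j≡i+n {i} {j} i≤j = ∣ j - i ∣ , (begin-equality
  j                ≡⟨ i+[j-i]≡j i j ⟨
  i + (j - i)      ≡⟨ cong (λ z → i + z) (ℤP.0≤i⇒+∣i∣≡i (ℤP.i≤j⇒0≤j-i i≤j)) ⟨
  i + + ∣ j - i ∣  ∎)

+-cancelˡ-≤ : ∀ k {i j : ℤ} → k + i ≤ k + j → i ≤ j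
+-cancelˡ-≤ k {i} {j} k+i≤k+j = begin
  i              ≡⟨ cancel k i ⟨
  - k + (k + i)  ≤⟨ ℤP.+-monoʳ-≤ (- k) k+i≤k+j ⟩
  - k + (k + j)  ≡⟨ cancel k j ⟩
  j              ∎
  where
  cancel : ∀ k i → - k + (k + i) ≡ i
  cancel = solve-∀

i≤j-1⇒i<j : ∀ {i j : ℤ} → i ≤ j - + 1 → i < j
i≤j-1⇒i<j {i} {j} i≤j-1 = ℤP.i≤pred[j]⇒i<j (subst (i ≤_) (ℤP.+-comm j (- + 1)) i≤j-1)

i<j-k⇒i+k<j : ∀ {i j k : ℤ} → i < j - k → i + k < j
i<j-k⇒i+k<j {i} {j} {k} i<j-k = subst (i + k <_) (i-j+j≡i j k) (ℤP.+-monoˡ-< k i<j-k)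

i-k+1≤j⇒i<j+k : ∀ {i j k : ℤ} → i - k + + 1 ≤ j → i < j + k
i-k+1≤j⇒i<j+k {i} {j} {k} i-k+1≤j = subst (_< j + k) (i-j+j≡i i k)
  (ℤP.+-monoˡ-< k {i - k} (ℤP.suc[i]≤j⇒i<j (subst (_≤ j) (ℤP.+-comm (i - k) (+ 1)) i-k+1≤j)))

Interval : ℤ → ℤ → ℤ → Set
Interval a b y = a ≤ y × y ≤ b

Interval-+⁺ : ∀ {a₁ b₁ a₂ b₂ s₁ s₂ : ℤ} → Interval a₁ b₁ s₁ → Interval a₂ b₂ s₂
            → Interval (a₁ + a₂) (b₁ + b₂) (s₁ + s₂)
Interval-+⁺ (a₁≤s₁ , s₁≤b₁) (a₂≤s₂ , s₂≤b₂) = ℤP.+-mono-≤ a₁≤s₁ a₂≤s₂ , ℤP.+-mono-≤ s₁≤b₁ s₂≤b₂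

Interval-+⁻ : ∀ {a₁ b₁ a₂ b₂ s : ℤ} → a₁ ≤ b₁ → a₂ ≤ b₂ → Interval (a₁ + a₂) (b₁ + b₂) s
            → Σ ℤ λ s₁ → Interval a₁ b₁ s₁ × Interval a₂ b₂ (s - s₁)
Interval-+⁻ {a₁} {b₁} {a₂} {b₂} {s} a₁≤b₁ a₂≤b₂ (lo≤s , s≤hi) with s - a₂ ℤP.≤? b₁
... | yes s-a₂≤b₁ =
    s - a₂ , (a₁≤s-a₂ , s-a₂≤b₁)
  , ℤP.≤-reflexive (sym (i-[i-j]≡j s a₂)) , ℤP.≤-trans (ℤP.≤-reflexive (i-[i-j]≡j s a₂)) a₂≤b₂
  where
  a₁≤s-a₂ : a₁ ≤ s - a₂
  a₁≤s-a₂ = ℤP.≤-trans (ℤP.≤-reflexive (sym (i+j-j≡i a₁ a₂))) (ℤP.+-monoˡ-≤ (- a₂) lo≤s)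
... | no s-a₂≰b₁ = b₁ , (a₁≤b₁ , ℤP.≤-refl) , a₂≤s-b₁ , s-b₁≤b₂
  where
  a₂≤s-b₁ : a₂ ≤ s - b₁
  a₂≤s-b₁ = begin
    a₂                ≡⟨ i+j-i≡j b₁ a₂ ⟨
    b₁ + a₂ - b₁      ≤⟨ ℤP.+-monoˡ-≤ (- b₁) (ℤP.+-monoˡ-≤ a₂ (ℤP.<⇒≤ (ℤP.≰⇒> s-a₂≰b₁))) ⟩
    s - a₂ + a₂ - b₁  ≡⟨ cong (_- b₁) (i-j+j≡i s a₂) ⟩
    s - b₁            ∎
  s-b₁≤b₂ : s - b₁ ≤ b₂
  s-b₁≤b₂ = ℤP.≤-trans (ℤP.+-monoˡ-≤ (- b₁) s≤hi) (ℤP.≤-reflexive (i+j-i≡j b₁ b₂))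

Interval-point : ∀ {a b s : ℤ} → a ≡ b → Interval a b s ⇔ s ≡ a
Interval-point refl = mk⇔ (λ (a≤s , s≤a) → ℤP.≤-antisym s≤a a≤s) (λ { refl → ℤP.≤-refl , ℤP.≤-refl })

triangular : ℕ → ℤ
triangular zero    = 0ℤ
triangular (suc m) = + m + triangular m

triangular-+ : ∀ m n → triangular (m ℕ.+ n) ≡ triangular m + triangular n + + m * + n
triangular-+ zero    n = identity (triangular n)
  where
  identity : ∀ t → t ≡ 0ℤ + t + 0ℤ
  identity = solve-∀
triangular-+ (suc m) n = begin-equality
  + m + + n + triangular (m ℕ.+ n)
    ≡⟨ cong (λ z → + m + + n + z) (triangular-+ m n) ⟩
  + m + + n + (triangular m + triangular n + + m * + n)
    ≡⟨ identity (+ m) (+ n) (triangular m) (triangular n) ⟩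
  + m + triangular m + triangular n + + suc m * + n ∎
  where
  identity : ∀ m n tm tn → m + n + (tm + tn + m * n) ≡ m + tm + tn + (+ 1 + m) * n
  identity = solve-∀

triangular-double : ∀ m → triangular m + triangular m + + m ≡ + m * + m
triangular-double zero    = refl
triangular-double (suc m) = begin-equality
  (+ m + t) + (+ m + t) + + suc m   ≡⟨ regroup (+ m) t ⟩
  (t + t + + m) + (+ m + + m + + 1) ≡⟨ cong (_+ (+ m + + m + + 1)) (triangular-double m) ⟩
  + m * + m + (+ m + + m + + 1)     ≡⟨ square (+ m) ⟩
  + suc m * + suc m                 ∎
  where
  t = triangular m
  regroup : ∀ m t → (m + t) + (m + t) + (+ 1 + m) ≡ (t + t + m) + (m + m + + 1)
  regroup = solve-∀
  square : ∀ m → m * m + (m + m + + 1) ≡ (+ 1 + m) * (+ 1 + m)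
  square = solve-∀

sumℤ-─ : ∀ {a : ℤ} {L} (a∈L : a ∈ L) → sumℤ L ≡ a + sumℤ (L ─ a∈L)
sumℤ-─ (here refl) = refl
sumℤ-─ {a} {b ∷ L} (there a∈L) = begin-equality
  b + sumℤ L                ≡⟨ cong (λ z → b + z) (sumℤ-─ a∈L) ⟩
  b + (a + sumℤ (L ─ a∈L))  ≡⟨ exchange b a _ ⟩
  a + (b + sumℤ (L ─ a∈L))  ∎
  where
  exchange : ∀ x y z → x + (y + z) ≡ y + (x + z)
  exchange = solve-∀

length-─ : ∀ {a : ℤ} {L} (a∈L : a ∈ L) → length L ≡ suc (length (L ─ a∈L))
length-─ (here _)    = refl
length-─ (there a∈L) = cong suc (length-─ a∈L)

Unique-─ : ∀ {a : ℤ} {L} (a∈L : a ∈ L) → Unique L → Unique (L ─ a∈L)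
Unique-─ (here _)    (_ ∷ u)  = u
Unique-─ (there a∈L) (b∉ ∷ u) = AllP.─⁺ a∈L b∉ ∷ Unique-─ a∈L u

≢-─ : ∀ {a : ℤ} {L} (a∈L : a ∈ L) → Unique L → All (_≢ a) (L ─ a∈L)
≢-─ (here refl) (a∉ ∷ _) = All.map ≢-sym a∉
≢-─ (there a∈L) (b∉ ∷ u) = All.lookup b∉ a∈L ∷ ≢-─ a∈L u

sumℤ-map-neg : ∀ L → sumℤ (map -_ L) ≡ - sumℤ L
sumℤ-map-neg []      = refl
sumℤ-map-neg (y ∷ L) = begin-equality
  - y + sumℤ (map -_ L) ≡⟨ cong (λ z → - y + z) (sumℤ-map-neg L) ⟩
  - y + - sumℤ L        ≡⟨ ℤP.neg-distrib-+ y (sumℤ L) ⟨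
  - (y + sumℤ L)        ∎

sumℤ-++ : ∀ L M → sumℤ (L ++ M) ≡ sumℤ L + sumℤ M
sumℤ-++ []      M = sym (ℤP.+-identityˡ (sumℤ M))
sumℤ-++ (y ∷ L) M = trans (cong (λ z → y + z) (sumℤ-++ L M)) (sym (ℤP.+-assoc y (sumℤ L) (sumℤ M)))

-- Restricted sumsets of intervals and of disjoint unions

Interval-shrinkˡ : ∀ {a b y} → Interval a b y → y ≢ a → Interval (+ 1 + a) b y
Interval-shrinkˡ (a≤y , y≤b) y≢a = ℤP.i<j⇒suc[i]≤j (ℤP.≤∧≢⇒< a≤y (≢-sym y≢a)) , y≤b

shift-suc : ∀ a b n → + 1 + b ≤ a + + suc n → + 1 + b ≤ (+ 1 + a) + + n
shift-suc a b n b<a+n = ℤP.≤-trans b<a+n (ℤP.≤-reflexive (shuffle a (+ n)))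
  where
  shuffle : ∀ a n → a + (+ 1 + n) ≡ + 1 + a + n
  shuffle = solve-∀

-- n bounds the length of [a, b]: either a ∈ L is removed from L, or L ⊆ [a + 1, b].
sum-distinct-≥-bounded : ∀ n {a b L} → + 1 + b ≤ a + + n → Unique L → All (Interval a b) L
                       → triangular (length L) + + length L * a ≤ sumℤ L
sum-distinct-≥-bounded zero    b<a []      []                  = ℤP.≤-refl
sum-distinct-≥-bounded zero {a} b<a (_ ∷ _) ((a≤y , y≤b) ∷ _) = ⊥-elim (ℤP.<-irrefl refl (ℤP.suc[i]≤j⇒i<j
  (ℤP.≤-trans b<a (ℤP.≤-trans (ℤP.≤-reflexive (ℤP.+-identityʳ a)) (ℤP.≤-trans a≤y y≤b)))))
sum-distinct-≥-bounded (suc n) {a} {b} {L} b<a+n uq inL with a ∈? L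
... | yes a∈L = begin
  triangular (length L) + + length L * a  ≡⟨ cong (λ m → triangular m + + m * a) (length-─ a∈L) ⟩
  triangular (suc m) + + suc m * a        ≡⟨ regroup (+ m) (triangular m) a ⟩
  a + (triangular m + + m * (+ 1 + a))
    ≤⟨ ℤP.+-monoʳ-≤ a (sum-distinct-≥-bounded n (shift-suc a b n b<a+n) (Unique-─ a∈L uq) inL′) ⟩
  a + sumℤ (L ─ a∈L)                      ≡⟨ sumℤ-─ a∈L ⟨
  sumℤ L                                  ∎
  where
  m = length (L ─ a∈L)
  inL′ : All (Interval (+ 1 + a) b) (L ─ a∈L)
  inL′ = All.zipWith (λ (y∈ , y≢a) → Interval-shrinkˡ y∈ y≢a) (AllP.─⁺ a∈L inL , ≢-─ a∈L uq)
  regroup : ∀ m t a → (m + t) + (+ 1 + m) * a ≡ a + (t + m * (+ 1 + a))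
  regroup = solve-∀
... | no a∉L = begin
  triangular m + + m * a                  ≤⟨ ℤP.i≤i+j _ (+ m) ⟩
  triangular m + + m * a + + m            ≡⟨ regroup (+ m) (triangular m) a ⟩
  triangular m + + m * (+ 1 + a)          ≤⟨ sum-distinct-≥-bounded n (shift-suc a b n b<a+n) uq inL′ ⟩
  sumℤ L                                  ∎
  where
  m = length L
  inL′ : All (Interval (+ 1 + a) b) L
  inL′ = All.tabulate (λ {y} y∈L → Interval-shrinkˡ (All.lookup inL y∈L) (λ y≡a → a∉L (subst (_∈ L) y≡a y∈L)))
  regroup : ∀ m t a → t + m * a + m ≡ t + m * (+ 1 + a)
  regroup = solve-∀

sum-distinct-≥ : ∀ {a b : ℤ} {L} → Unique L → All (Interval a b) L
               → triangular (length L) + + length L * a ≤ sumℤ L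
sum-distinct-≥ {a} {b} with ℤP.≤-total a b
... | inj₁ a≤b = let d , b≡a+d = i≤j⇒∃[n]j≡i+n a≤b in
  sum-distinct-≥-bounded (suc d) (ℤP.≤-reflexive (trans (cong (λ z → + 1 + z) b≡a+d) (shuffle a (+ d))))
  where
  shuffle : ∀ a d → + 1 + (a + d) ≡ a + (+ 1 + d)
  shuffle = solve-∀
... | inj₂ b≤a =
  sum-distinct-≥-bounded 1 (ℤP.≤-trans (ℤP.+-monoʳ-≤ (+ 1) b≤a) (ℤP.≤-reflexive (ℤP.+-comm (+ 1) a)))

sum-distinct-≤ : ∀ {a b : ℤ} {L} → Unique L → All (Interval a b) L
               → sumℤ L ≤ triangular (length L) + + length L * (b + + 1 - + length L)
sum-distinct-≤ {a} {b} {L} uq inL = begin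
  sumℤ L                          ≡⟨ ℤP.neg-involutive (sumℤ L) ⟨
  - - sumℤ L                      ≡⟨ cong -_ (sumℤ-map-neg L) ⟨
  - sumℤ (map -_ L)               ≤⟨ ℤP.neg-mono-≤ negated ⟩
  - (t + + m * - b)               ≡⟨ regroup (+ m) b t ⟩
  t + + m * (b + + 1 - + m) + (+ m * + m - (t + t + + m))
    ≡⟨ cong (λ z → t + + m * (b + + 1 - + m) + (+ m * + m - z)) (triangular-double m) ⟩
  t + + m * (b + + 1 - + m) + (+ m * + m - + m * + m)
    ≡⟨ cancel (t + + m * (b + + 1 - + m)) (+ m * + m) ⟩
  t + + m * (b + + 1 - + m)       ∎
  where
  m = length L
  t = triangular m
  negated : t + + m * - b ≤ sumℤ (map -_ L)
  negated = subst (λ n → triangular n + + n * - b ≤ sumℤ (map -_ L)) (length-map -_ L)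
    (sum-distinct-≥ (UniqueP.map⁺ ℤP.neg-injective uq)
                    (AllP.map⁺ (All.map (λ (a≤y , y≤b) → ℤP.neg-mono-≤ y≤b , ℤP.neg-mono-≤ a≤y) inL)))
  regroup : ∀ m b t → - (t + m * - b) ≡ t + m * (b + + 1 - m) + (m * m - (t + t + m))
  regroup = solve-∀
  cancel : ∀ x y → x + (y - y) ≡ x
  cancel = solve-∀

restrictedSumset-Interval⁻ : ∀ {m a b s} → RestrictedSumset m (Interval a b) s
  → Interval (triangular m + + m * a) (triangular m + + m * (b + + 1 - + m)) s
restrictedSumset-Interval⁻ (L , uq , refl , inL , refl) = sum-distinct-≥ uq inL , sum-distinct-≤ uq inL

restrictedSumset-Interval-size : ∀ {m a b s} → RestrictedSumset m (Interval a b) s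
                               → m ≡ 0 ⊎ a + + m ≤ b + + 1
restrictedSumset-Interval-size {zero}          _ = inj₁ refl
restrictedSumset-Interval-size {suc m} {a} {b} S = inj₂ (begin
  a + + suc m                  ≤⟨ ℤP.+-monoˡ-≤ (+ suc m) a≤b+1-m ⟩
  b + + 1 - + suc m + + suc m  ≡⟨ i-j+j≡i (b + + 1) (+ suc m) ⟩
  b + + 1                      ∎)
  where
  a≤b+1-m : a ≤ b + + 1 - + suc m
  a≤b+1-m = let lo≤s , s≤hi = restrictedSumset-Interval⁻ S in
    ℤP.*-cancelˡ-≤-pos a _ (+ suc m) (+-cancelˡ-≤ (triangular (suc m)) (ℤP.≤-trans lo≤s s≤hi))

restrictedSumset-∷ : ∀ {m a b c s} → a ≤ c → c ≤ b → RestrictedSumset m (Interval a (c - + 1)) (s - c)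
                   → RestrictedSumset (suc m) (Interval a b) s
restrictedSumset-∷ {c = c} {s} a≤c c≤b (L , uq , refl , inL , sum≡) =
    c ∷ L
  , All.map (λ (_ , y≤c-1) c≡y → ℤP.<-irrefl (sym c≡y) (i≤j-1⇒i<j y≤c-1)) inL ∷ uq
  , refl
  , (a≤c , c≤b) ∷ All.map (λ (a≤y , y≤c-1) → a≤y , ℤP.≤-trans (ℤP.<⇒≤ (i≤j-1⇒i<j y≤c-1)) c≤b) inL
  , trans (cong (λ z → c + z) sum≡) (i+[j-i]≡j c s)

-- The largest summand is b when the other m summands can still reach s - b; otherwise
-- it is s - lo, the other m summands then being forced to have the least sum lo.
largest-summand : ∀ m {a b s} → a + + suc m ≤ b + + 1
  → Interval (triangular (suc m) + + suc m * a) (triangular (suc m) + + suc m * (b + + 1 - + suc m)) s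
  → Σ ℤ λ c → a + + m ≤ c × c ≤ b × Interval (triangular m + + m * a) (triangular m + + m * (c - + m)) (s - c)
largest-summand m {a} {b} {s} a+m<b+1 (lo′≤s , s≤hi′) with triangular m + + m * a ℤP.≤? s - b
... | yes lo≤s-b = b , a+m≤b , ℤP.≤-refl , lo≤s-b , s-b≤hi
  where
  a+m≤b : a + + m ≤ b
  a+m≤b = +-cancelˡ-≤ (+ 1) (begin
    + 1 + (a + + m)  ≡⟨ shuffle a (+ m) ⟩
    a + + suc m      ≤⟨ a+m<b+1 ⟩
    b + + 1          ≡⟨ ℤP.+-comm b (+ 1) ⟩
    + 1 + b          ∎)
    where
    shuffle : ∀ a m → + 1 + (a + m) ≡ a + (+ 1 + m)
    shuffle = solve-∀
  s-b≤hi : s - b ≤ triangular m + + m * (b - + m)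
  s-b≤hi = ℤP.≤-trans (ℤP.+-monoˡ-≤ (- b) s≤hi′) (ℤP.≤-reflexive (drop-top (+ m) b (triangular m)))
    where
    drop-top : ∀ m b t → m + t + (+ 1 + m) * (b + + 1 - (+ 1 + m)) - b ≡ t + m * (b - m)
    drop-top = solve-∀
... | no lo≰s-b = c , a+m≤c , c≤b , ℤP.≤-reflexive (sym s-c≡lo) , ℤP.≤-trans (ℤP.≤-reflexive s-c≡lo) lo≤hi
  where
  lo = triangular m + + m * a
  c = s - lo
  s-c≡lo : s - c ≡ lo
  s-c≡lo = i-[i-j]≡j s lo
  a+m≤c : a + + m ≤ c
  a+m≤c = ℤP.≤-trans (ℤP.≤-reflexive (sym (drop-bottom (+ m) a (triangular m)))) (ℤP.+-monoˡ-≤ (- lo) lo′≤s)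
    where
    drop-bottom : ∀ m a t → m + t + (+ 1 + m) * a - (t + m * a) ≡ a + m
    drop-bottom = solve-∀
  c≤b : c ≤ b
  c≤b = begin
    s - lo              ≡⟨ split s b lo ⟩
    (s - b) + (b - lo)  ≤⟨ ℤP.+-monoˡ-≤ (b - lo) (ℤP.<⇒≤ (ℤP.≰⇒> lo≰s-b)) ⟩
    lo + (b - lo)       ≡⟨ i+[j-i]≡j lo b ⟩
    b                   ∎
    where
    split : ∀ s b x → s - x ≡ (s - b) + (b - x)
    split = solve-∀
  lo≤hi : lo ≤ triangular m + + m * (c - + m)
  lo≤hi = ℤP.+-monoʳ-≤ (triangular m) (ℤP.*-monoˡ-≤-nonNeg (+ m)
    (ℤP.≤-trans (ℤP.≤-reflexive (sym (i+j-j≡i a (+ m)))) (ℤP.+-monoˡ-≤ (- + m) a+m≤c)))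

restrictedSumset-Interval⁺ : ∀ m {a b s} → a + + m ≤ b + + 1
  → Interval (triangular m + + m * a) (triangular m + + m * (b + + 1 - + m)) s
  → RestrictedSumset m (Interval a b) s
restrictedSumset-Interval⁺ zero    _ (0≤s , s≤0) = [] , [] , refl , [] , ℤP.≤-antisym 0≤s s≤0
restrictedSumset-Interval⁺ (suc m) {a} {s = s} a+m<b+1 s∈ =
  let c , a+m≤c , c≤b , s-c∈ = largest-summand m a+m<b+1 s∈ in
  restrictedSumset-∷ (ℤP.≤-trans (ℤP.i≤i+j a (+ m)) a+m≤c) c≤b
    (restrictedSumset-Interval⁺ m (subst (a + + m ≤_) (sym (i-j+j≡i c (+ 1))) a+m≤c)
      (subst (λ z → Interval (triangular m + + m * a) (triangular m + + m * (z - + m)) (s - c))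
             (sym (i-j+j≡i c (+ 1))) s-c∈))

restrictedSumset-mono : ∀ {P Q : ℤ → Set} {h s} → (∀ {y} → P y → Q y)
                      → RestrictedSumset h P s → RestrictedSumset h Q s
restrictedSumset-mono P⊆Q (L , uq , len , inL , sum≡) = L , uq , len , All.map P⊆Q inL , sum≡

module _ {P : ℤ → Set} (P? : Decidable P) where

  length-filter-∁ : ∀ L → length (filter P? L) ℕ.+ length (filter (∁? P?) L) ≡ length L
  length-filter-∁ []      = refl
  length-filter-∁ (y ∷ L) with P? y
  ... | yes _ = cong suc (length-filter-∁ L)
  ... | no  _ = trans (ℕP.+-suc _ _) (cong suc (length-filter-∁ L))

  sumℤ-filter-∁ : ∀ L → sumℤ (filter P? L) + sumℤ (filter (∁? P?) L) ≡ sumℤ L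
  sumℤ-filter-∁ []      = refl
  sumℤ-filter-∁ (y ∷ L) with P? y
  ... | yes _ = trans (ℤP.+-assoc y _ _) (cong (λ z → y + z) (sumℤ-filter-∁ L))
  ... | no  _ = trans (exchange (sumℤ (filter P? L)) y (sumℤ (filter (∁? P?) L)))
                      (cong (λ z → y + z) (sumℤ-filter-∁ L))
    where
    exchange : ∀ a y b → a + (y + b) ≡ y + (a + b)
    exchange = solve-∀

restrictedSumset-⊎ : ∀ {B C : ℤ → Set} → Decidable B → (∀ {y} → B y → ¬ C y) → ∀ {h s}
  → RestrictedSumset h (λ y → B y ⊎ C y) s
    ⇔ (Σ ℕ λ u → Σ ℕ λ t → u ℕ.+ t ≡ h
         × Σ ℤ λ s₁ → RestrictedSumset u B s₁ × RestrictedSumset t C (s - s₁))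
restrictedSumset-⊎ {B} {C} B? disjoint = mk⇔ split merge
  where
  split : ∀ {h s} → RestrictedSumset h (λ y → B y ⊎ C y) s
        → Σ ℕ λ u → Σ ℕ λ t → u ℕ.+ t ≡ h
            × Σ ℤ λ s₁ → RestrictedSumset u B s₁ × RestrictedSumset t C (s - s₁)
  split (L , uq , refl , inL , refl) =
      length L₁ , length L₂ , length-filter-∁ B? L
    , sumℤ L₁
    , (L₁ , UniqueP.filter⁺ B? uq , refl , AllP.all-filter B? L , refl)
    , (L₂ , UniqueP.filter⁺ (∁? B?) uq , refl , inL₂ , sumL₂)
    where
    L₁ = filter B? L
    L₂ = filter (∁? B?) L
    inL₂ : All C L₂
    inL₂ = All.zipWith (λ { (¬By , inj₁ By) → ⊥-elim (¬By By) ; (_ , inj₂ Cy) → Cy })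
                       (AllP.all-filter (∁? B?) L , AllP.filter⁺ (∁? B?) inL)
    sumL₂ : sumℤ L₂ ≡ sumℤ L - sumℤ L₁
    sumL₂ = begin-equality
      sumℤ L₂                      ≡⟨ i+j-i≡j (sumℤ L₁) (sumℤ L₂) ⟨
      sumℤ L₁ + sumℤ L₂ - sumℤ L₁  ≡⟨ cong (_- sumℤ L₁) (sumℤ-filter-∁ B? L) ⟩
      sumℤ L - sumℤ L₁             ∎
  merge : ∀ {h s} → (Σ ℕ λ u → Σ ℕ λ t → u ℕ.+ t ≡ h
            × Σ ℤ λ s₁ → RestrictedSumset u B s₁ × RestrictedSumset t C (s - s₁))
        → RestrictedSumset h (λ y → B y ⊎ C y) s
  merge {s = s} (_ , _ , refl , s₁ , (L₁ , uq₁ , refl , inL₁ , refl) , (L₂ , uq₂ , refl , inL₂ , sumL₂)) =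
      L₁ ++ L₂
    , UniqueP.++⁺ uq₁ uq₂ (λ (y∈L₁ , y∈L₂) → disjoint (All.lookup inL₁ y∈L₁) (All.lookup inL₂ y∈L₂))
    , length-++ L₁
    , AllP.++⁺ (All.map inj₁ inL₁) (All.map inj₂ inL₂)
    , trans (sumℤ-++ L₁ L₂) (trans (cong (λ z → sumℤ L₁ + z) sumL₂) (i+[j-i]≡j (sumℤ L₁) s))

-- Unions of chained intervals, and their cardinality

module _ (lo hi : ℕ → ℤ) where

  InUnion : ℕ → ℕ → ℤ → Set
  InUnion t₀ t₁ s = Σ ℕ λ t → t₀ ℕ.≤ t × t ℕ.≤ t₁ × Interval (lo t) (hi t) s

  Chained : ℕ → ℕ → Set
  Chained t₀ t₁ = ∀ t → t₀ ℕ.≤ t → t ℕ.< t₁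
                → lo t ≤ lo (suc t) × hi t ≤ hi (suc t) × lo (suc t) ≤ hi t + + 1

  module _ {t₀ t₁ : ℕ} (chained : Chained t₀ t₁) where

    lo-mono : ∀ {t} → t₀ ≤′ t → t ℕ.≤ t₁ → lo t₀ ≤ lo t
    lo-mono ≤′-refl          _      = ℤP.≤-refl
    lo-mono (≤′-step t₀≤′t) 1+t≤t₁ =
      ℤP.≤-trans (lo-mono t₀≤′t (ℕP.<⇒≤ 1+t≤t₁)) (proj₁ (chained _ (ℕP.≤′⇒≤ t₀≤′t) 1+t≤t₁))

    hi-mono : ∀ {t t′} → t₀ ℕ.≤ t → t ≤′ t′ → t′ ℕ.≤ t₁ → hi t ≤ hi t′
    hi-mono _    ≤′-refl          _       = ℤP.≤-refl
    hi-mono t₀≤t (≤′-step t≤′t′) 1+t′≤t₁ = ℤP.≤-trans (hi-mono t₀≤t t≤′t′ (ℕP.<⇒≤ 1+t′≤t₁))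
      (proj₁ (proj₂ (chained _ (ℕP.≤-trans t₀≤t (ℕP.≤′⇒≤ t≤′t′)) 1+t′≤t₁)))

    cover : ∀ {t s} → t₀ ≤′ t → t ℕ.≤ t₁ → Interval (lo t₀) (hi t) s → InUnion t₀ t s
    cover ≤′-refl _ s∈ = t₀ , ℕP.≤-refl , ℕP.≤-refl , s∈
    cover {suc t} {s} (≤′-step t₀≤′t) 1+t≤t₁ (lo≤s , s≤hi) with s ℤP.≤? hi t
    ... | yes s≤hi-t = let t′ , t₀≤t′ , t′≤t , s∈ = cover t₀≤′t (ℕP.<⇒≤ 1+t≤t₁) (lo≤s , s≤hi-t) in
      t′ , t₀≤t′ , ℕP.m≤n⇒m≤1+n t′≤t , s∈
    ... | no  s≰hi-t = suc t , ℕP.≤′⇒≤ (≤′-step t₀≤′t) , ℕP.≤-refl , (lo≤s′ , s≤hi)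
      where
      lo≤s′ : lo (suc t) ≤ s
      lo≤s′ = ℤP.≤-trans (proj₂ (proj₂ (chained t (ℕP.≤′⇒≤ t₀≤′t) 1+t≤t₁)))
                         (subst (_≤ s) (ℤP.+-comm (+ 1) (hi t)) (ℤP.i<j⇒suc[i]≤j (ℤP.≰⇒> s≰hi-t)))

    ⋃-chain : ∀ {s} → t₀ ℕ.≤ t₁ → InUnion t₀ t₁ s ⇔ Interval (lo t₀) (hi t₁) s
    ⋃-chain t₀≤t₁ = mk⇔
      (λ (t , t₀≤t , t≤t₁ , lo≤s , s≤hi) →
         ℤP.≤-trans (lo-mono (ℕP.≤⇒≤′ t₀≤t) t≤t₁) lo≤s , ℤP.≤-trans s≤hi (hi-mono t₀≤t (ℕP.≤⇒≤′ t≤t₁) ℕP.≤-refl))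
      (cover (ℕP.≤⇒≤′ t₀≤t₁) ℕP.≤-refl)

module _ {lo hi : ℕ → ℤ} {t₀ : ℕ} where

  InUnion-split-first : ∀ {t₁ s} → t₀ ℕ.≤ t₁
    → InUnion lo hi t₀ t₁ s ⇔ (Interval (lo t₀) (hi t₀) s ⊎ InUnion lo hi (suc t₀) t₁ s)
  InUnion-split-first t₀≤t₁ = mk⇔ split
    (λ { (inj₁ s∈) → t₀ , ℕP.≤-refl , t₀≤t₁ , s∈
       ; (inj₂ (t , t₀<t , t≤t₁ , s∈)) → t , ℕP.<⇒≤ t₀<t , t≤t₁ , s∈ })
    where
    split : ∀ {t₁ s} → InUnion lo hi t₀ t₁ s → Interval (lo t₀) (hi t₀) s ⊎ InUnion lo hi (suc t₀) t₁ s
    split (t , t₀≤t , t≤t₁ , s∈) with ℕP.m≤n⇒m<n∨m≡n t₀≤t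
    ... | inj₁ t₀<t = inj₂ (t , t₀<t , t≤t₁ , s∈)
    ... | inj₂ refl = inj₁ s∈

  InUnion-split-last : ∀ {t₁ s} → t₀ ℕ.≤ suc t₁
    → InUnion lo hi t₀ (suc t₁) s ⇔ (InUnion lo hi t₀ t₁ s ⊎ Interval (lo (suc t₁)) (hi (suc t₁)) s)
  InUnion-split-last t₀≤1+t₁ = mk⇔ split
    (λ { (inj₁ (t , t₀≤t , t≤t₁ , s∈)) → t , t₀≤t , ℕP.m≤n⇒m≤1+n t≤t₁ , s∈
       ; (inj₂ s∈) → _ , t₀≤1+t₁ , ℕP.≤-refl , s∈ })
    where
    split : ∀ {t₁ s} → InUnion lo hi t₀ (suc t₁) s → InUnion lo hi t₀ t₁ s ⊎ Interval (lo (suc t₁)) (hi (suc t₁)) s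
    split (t , t₀≤t , t≤1+t₁ , s∈) with ℕP.m≤n⇒m<n∨m≡n t≤1+t₁
    ... | inj₁ t<1+t₁ = inj₁ (t , t₀≤t , ℕ.s≤s⁻¹ t<1+t₁ , s∈)
    ... | inj₂ refl   = inj₂ s∈

hasCard-resp : ∀ {P Q : ℤ → Set} {n} → (∀ s → P s ⇔ Q s) → HasCard P n → HasCard Q n
hasCard-resp P⇔Q (S , uq , len , S⇔P) = S , uq , len , λ s → ⇔.trans (S⇔P s) (P⇔Q s)

hasCard-insert : ∀ {P : ℤ → Set} {n p} → ¬ P p → HasCard P n → HasCard (λ s → s ≡ p ⊎ P s) (suc n)
hasCard-insert {P} {p = p} ¬Pp (S , uq , refl , S⇔P) =
    p ∷ S
  , All.tabulate (λ {y} y∈S p≡y → ¬Pp (subst P (sym p≡y) (Equivalence.to (S⇔P y) y∈S))) ∷ uq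
  , refl
  , λ s → mk⇔ (λ { (here s≡p) → inj₁ s≡p ; (there s∈S) → inj₂ (Equivalence.to (S⇔P s) s∈S) })
              (λ { (inj₁ s≡p) → here s≡p ; (inj₂ Ps) → there (Equivalence.from (S⇔P s) Ps) })

hasCard-Interval : ∀ {a b : ℤ} n → b + + 1 ≡ a + + n → HasCard (Interval a b) n
hasCard-Interval {a} {b} n b+1≡a+n =
  applyUpTo (λ i → a + + i) n , unique , length-applyUpTo _ n , λ s → mk⇔ (sound s) (complete s)
  where
  unique : Unique (applyUpTo (λ i → a + + i) n)
  unique = UniqueP.applyUpTo⁺₁ _ n (λ i<j _ a+i≡a+j → ℤP.<-irrefl a+i≡a+j (ℤP.+-monoʳ-< a (+<+ i<j)))
  shuffle : ∀ a i → + 1 + (a + i) ≡ a + (+ 1 + i)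
  shuffle = solve-∀
  sound : ∀ s → s ∈ applyUpTo (λ i → a + + i) n → Interval a b s
  sound s s∈ with ∈-applyUpTo⁻ (λ i → a + + i) s∈
  ... | i , i<n , refl = ℤP.i≤i+j a (+ i) , +-cancelˡ-≤ (+ 1) (begin
    + 1 + (a + + i)  ≡⟨ shuffle a (+ i) ⟩
    a + + suc i      ≤⟨ ℤP.+-monoʳ-≤ a (+≤+ i<n) ⟩
    a + + n          ≡⟨ b+1≡a+n ⟨
    b + + 1          ≡⟨ ℤP.+-comm b (+ 1) ⟩
    + 1 + b          ∎)
  complete : ∀ s → Interval a b s → s ∈ applyUpTo (λ i → a + + i) n
  complete s (a≤s , s≤b) = let i , s≡a+i = i≤j⇒∃[n]j≡i+n a≤s in
    subst (_∈ applyUpTo (λ i → a + + i) n) (sym s≡a+i) (∈-applyUpTo⁺ (λ i → a + + i) (i<n i s≡a+i))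
    where
    i<n : ∀ i → s ≡ a + + i → i ℕ.< n
    i<n i s≡a+i = ℤP.drop‿+≤+ (+-cancelˡ-≤ a (begin
      a + + suc i      ≡⟨ shuffle a (+ i) ⟨
      + 1 + (a + + i)  ≡⟨ cong (λ z → + 1 + z) s≡a+i ⟨
      + 1 + s          ≤⟨ ℤP.+-monoʳ-≤ (+ 1) s≤b ⟩
      + 1 + b          ≡⟨ ℤP.+-comm (+ 1) b ⟩
      b + + 1          ≡⟨ b+1≡a+n ⟩
      a + + n          ∎))

-- The set A = [0, k+1] ∖ {x, x+1}

2≤uv+tw : ∀ u t v w → 2 ℕ.≤ u ℕ.+ t → 2 ℕ.≤ v ℕ.+ w
  → (t ≡ 0 × v ≡ 0) ⊎ (u ≡ 0 × w ≡ 0) ⊎ 2 ℕ.≤ u ℕ.* v ℕ.+ t ℕ.* w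
2≤uv+tw zero    t       v       zero    _    _ = inj₂ (inj₁ (refl , refl))
2≤uv+tw zero    t       v       (suc w) 2≤t  _ = inj₂ (inj₂ (ℕP.≤-trans 2≤t (ℕP.m≤m*n t (suc w))))
2≤uv+tw (suc u) zero    zero    w       _    _ = inj₁ (refl , refl)
2≤uv+tw (suc u) zero    (suc v) w       2≤u  _ = inj₂ (inj₂ (ℕP.≤-trans
  (subst (2 ℕ.≤_) (ℕP.+-identityʳ (suc u)) 2≤u)
  (ℕP.≤-trans (ℕP.m≤m*n (suc u) (suc v)) (ℕP.m≤m+n _ 0))))
2≤uv+tw (suc u) (suc t) v       w       _ 2≤v+w =
  inj₂ (inj₂ (ℕP.≤-trans 2≤v+w (ℕP.+-mono-≤ (ℕP.m≤m+n v (u ℕ.* v)) (ℕP.m≤m+n w (t ℕ.* w)))))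

h+3≤k : ∀ h {k} → 3 ℕ.* h ℕ.+ 3 ℕ.≤ k → h ℕ.+ 3 ℕ.≤ k
h+3≤k h 3h+3≤k = ℕP.≤-trans (ℕP.+-monoˡ-≤ 3 (ℕP.m≤n*m h 3)) 3h+3≤k

h+h<k : ∀ h {k} → 3 ℕ.* h ℕ.+ 3 ℕ.≤ k → h ℕ.+ h ℕ.< k
h+h<k h 3h+3≤k =
  ℕP.<-≤-trans (ℕP.m<m+n (h ℕ.+ h) (ℕP.<-≤-trans (s≤s z≤n) (ℕP.m≤n+m 3 h)))
               (ℕP.≤-trans (ℕP.≤-reflexive (regroup h)) 3h+3≤k)
  where
  regroup : ∀ h → h ℕ.+ h ℕ.+ (h ℕ.+ 3) ≡ 3 ℕ.* h ℕ.+ 3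
  regroup = ℕ-solve-∀

module _ (h k x : ℕ) where

  Lower Upper : ℤ → Set
  Lower = Interval 0ℤ (+ x - + 1)
  Upper = Interval (+ x + + 2) (+ k + + 1)

  A⇔Lower⊎Upper : x ℕ.≤ k → ∀ y → A k (+ x) y ⇔ (Lower y ⊎ Upper y)
  A⇔Lower⊎Upper x≤k y = mk⇔ to from
    where
    x-1<x : + x - + 1 < + x
    x-1<x = i≤j-1⇒i<j ℤP.≤-refl
    x<x+1 : + x < + x + + 1
    x<x+1 = +<+ (ℕP.m<m+n x (s≤s z≤n))
    x+1<x+2 : + x + + 1 < + x + + 2
    x+1<x+2 = +<+ (ℕP.+-monoʳ-< x (ℕP.n<1+n 1))
    to : A k (+ x) y → Lower y ⊎ Upper y
    to (0≤y , y≤k+1 , y≢x , y≢x+1) with y ℤP.≤? + x - + 1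
    ... | yes y≤x-1 = inj₁ (0≤y , y≤x-1)
    ... | no  y≰x-1 = inj₂ (x+2≤y , y≤k+1)
      where
      x≤y : + x ≤ y
      x≤y = subst (_≤ y) (trans (ℤP.+-comm (+ 1) (+ x - + 1)) (i-j+j≡i (+ x) (+ 1)))
                  (ℤP.i<j⇒suc[i]≤j (ℤP.≰⇒> y≰x-1))
      x+1≤y : + x + + 1 ≤ y
      x+1≤y = subst (_≤ y) (ℤP.+-comm (+ 1) (+ x)) (ℤP.i<j⇒suc[i]≤j (ℤP.≤∧≢⇒< x≤y (≢-sym y≢x)))
      x+2≤y : + x + + 2 ≤ y
      x+2≤y = subst (_≤ y) (trans (ℤP.+-comm (+ 1) (+ x + + 1)) (ℤP.+-assoc (+ x) (+ 1) (+ 1)))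
                    (ℤP.i<j⇒suc[i]≤j (ℤP.≤∧≢⇒< x+1≤y (≢-sym y≢x+1)))
    from : Lower y ⊎ Upper y → A k (+ x) y
    from (inj₁ (0≤y , y≤x-1)) =
      0≤y , ℤP.≤-trans y≤x-1 (ℤP.≤-trans (ℤP.<⇒≤ x-1<x) (+≤+ (ℕP.m≤n⇒m≤n+o 1 x≤k))) ,
      ℤP.<⇒≢ y<x , ℤP.<⇒≢ (ℤP.<-trans y<x x<x+1)
      where
      y<x : y < + x
      y<x = ℤP.≤-<-trans y≤x-1 x-1<x
    from (inj₂ (x+2≤y , y≤k+1)) =
      ℤP.≤-trans (+≤+ z≤n) x+2≤y , y≤k+1 ,
      ≢-sym (ℤP.<⇒≢ (ℤP.<-≤-trans (ℤP.<-trans x<x+1 x+1<x+2) x+2≤y)) ,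
      ≢-sym (ℤP.<⇒≢ (ℤP.<-≤-trans x+1<x+2 x+2≤y))

  -- t counts the summands taken from Upper.  The sums of h distinct elements of A with
  -- exactly t of them in Upper fill [lowest t, highest t]; such choices exist iff t is
  -- admissible, i.e. h - x ≤ t ≤ min h (k - x).
  Admissible : ℕ → Set
  Admissible t = h ℕ.≤ x ℕ.+ t × t ℕ.≤ h × x ℕ.+ t ℕ.≤ k

  lowest highest : ℕ → ℤ
  lowest  t = triangular h + + t * (+ x + + 2 - + h + + t)
  highest t = triangular h + + h * (+ x - + h) + + t * (+ k - + x + + h + + 2 - + t)

  lowest-≡ : ∀ {u t} → u ℕ.+ t ≡ h
           → triangular u + + u * 0ℤ + (triangular t + + t * (+ x + + 2)) ≡ lowest t
  lowest-≡ {u} {t} refl = begin-equality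
    triangular u + + u * 0ℤ + (triangular t + + t * (+ x + + 2))
      ≡⟨ identity (triangular u) (triangular t) (+ u) (+ t) (+ x) ⟩
    triangular u + triangular t + + u * + t + + t * (+ x + + 2 - + (u ℕ.+ t) + + t)
      ≡⟨ cong (λ z → z + + t * (+ x + + 2 - + (u ℕ.+ t) + + t)) (triangular-+ u t) ⟨
    lowest t ∎
    where
    identity : ∀ tu tt u t x → tu + u * 0ℤ + (tt + t * (x + + 2))
                             ≡ tu + tt + u * t + t * (x + + 2 - (u + t) + t)
    identity = solve-∀

  highest-≡ : ∀ {u t} → u ℕ.+ t ≡ h
    → triangular u + + u * (+ x - + 1 + + 1 - + u) + (triangular t + + t * (+ k + + 1 + + 1 - + t)) ≡ highest t
  highest-≡ {u} {t} refl = begin-equality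
    triangular u + + u * (+ x - + 1 + + 1 - + u) + (triangular t + + t * (+ k + + 1 + + 1 - + t))
      ≡⟨ identity (triangular u) (triangular t) (+ u) (+ t) (+ x) (+ k) ⟩
    triangular u + triangular t + + u * + t + + (u ℕ.+ t) * (+ x - + (u ℕ.+ t))
      + + t * (+ k - + x + + (u ℕ.+ t) + + 2 - + t)
      ≡⟨ cong (λ z → z + + (u ℕ.+ t) * (+ x - + (u ℕ.+ t)) + + t * (+ k - + x + + (u ℕ.+ t) + + 2 - + t))
              (triangular-+ u t) ⟨
    highest t ∎
    where
    identity : ∀ tu tt u t x k → tu + u * (x - + 1 + + 1 - u) + (tt + t * (k + + 1 + + 1 - t))
                               ≡ tu + tt + u * t + (u + t) * (x - (u + t)) + t * (k - x + (u + t) + + 2 - t)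
    identity = solve-∀

  Lower∩Upper≡∅ : ∀ {y} → Lower y → ¬ Upper y
  Lower∩Upper≡∅ (_ , y≤x-1) (x+2≤y , _) = ℤP.<-irrefl refl (ℤP.≤-<-trans x+2≤y (ℤP.≤-<-trans y≤x-1 x-1<x+2))
    where
    x-1<x+2 : + x - + 1 < + x + + 2
    x-1<x+2 = i≤j-1⇒i<j (ℤP.≤-trans (ℤP.i≤i+j (+ x - + 1) (+ 2)) (ℤP.≤-reflexive (shuffle (+ x))))
      where
      shuffle : ∀ x → x - + 1 + + 2 ≡ x + + 2 - + 1
      shuffle = solve-∀

  restrictedSumset-Lower⊎Upper : ∀ {s} → RestrictedSumset h (λ y → Lower y ⊎ Upper y) s
    ⇔ (Σ ℕ λ u → Σ ℕ λ t → u ℕ.+ t ≡ h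
         × Σ ℤ λ s₁ → RestrictedSumset u Lower s₁ × RestrictedSumset t Upper (s - s₁))
  restrictedSumset-Lower⊎Upper = restrictedSumset-⊎ (λ y → 0ℤ ℤP.≤? y ×-dec y ℤP.≤? + x - + 1) Lower∩Upper≡∅

  restrictedSumset-A⇒ : x ℕ.≤ k → ∀ {s} → RestrictedSumset h (A k (+ x)) s
                      → Σ ℕ λ t → Admissible t × Interval (lowest t) (highest t) s
  restrictedSumset-A⇒ x≤k {s} S
    with u , t , u+t≡h , s₁ , S₁ , S₂ ← Equivalence.to restrictedSumset-Lower⊎Upper
                                          (restrictedSumset-mono (Equivalence.to (A⇔Lower⊎Upper x≤k _)) S) =
    t , (h≤x+t , subst (t ℕ.≤_) u+t≡h (ℕP.m≤n+m t u) , x+t≤k) ,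
    subst₂ (λ lo hi → Interval lo hi s) (lowest-≡ u+t≡h) (highest-≡ u+t≡h)
      (subst (Interval _ _) (i+[j-i]≡j s₁ s)
        (Interval-+⁺ (restrictedSumset-Interval⁻ S₁) (restrictedSumset-Interval⁻ S₂)))
    where
    h≤x+t : h ℕ.≤ x ℕ.+ t
    h≤x+t with restrictedSumset-Interval-size S₁
    ... | inj₁ refl = subst (ℕ._≤ x ℕ.+ t) u+t≡h (ℕP.m≤n+m t x)
    ... | inj₂ u≤x  = subst (ℕ._≤ x ℕ.+ t) u+t≡h
      (ℕP.+-monoˡ-≤ t (ℤP.drop‿+≤+ (subst (+ u ≤_) (i-j+j≡i (+ x) (+ 1)) u≤x)))
    x+t≤k : x ℕ.+ t ℕ.≤ k
    x+t≤k with restrictedSumset-Interval-size S₂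
    ... | inj₁ refl = subst (ℕ._≤ k) (sym (ℕP.+-identityʳ x)) x≤k
    ... | inj₂ x+2+t≤k+2 = ℕP.+-cancelʳ-≤ 2 (x ℕ.+ t) k
      (subst₂ ℕ._≤_ (shuffle x t) (ℕP.+-assoc k 1 1) (ℤP.drop‿+≤+ x+2+t≤k+2))
      where
      shuffle : ∀ x t → x ℕ.+ 2 ℕ.+ t ≡ x ℕ.+ t ℕ.+ 2
      shuffle = ℕ-solve-∀

  restrictedSumset-A⇐ : x ℕ.≤ k → ∀ {s} → (Σ ℕ λ t → Admissible t × Interval (lowest t) (highest t) s)
                      → RestrictedSumset h (A k (+ x)) s
  restrictedSumset-A⇐ x≤k {s} (t , (h≤x+t , t≤h , x+t≤k) , s∈) =
    let s₁ , s₁∈ , s-s₁∈ = Interval-+⁻ lo₁≤hi₁ lo₂≤hi₂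
          (subst₂ (λ lo hi → Interval lo hi s) (sym (lowest-≡ u+t≡h)) (sym (highest-≡ u+t≡h)) s∈) in
    restrictedSumset-mono (Equivalence.from (A⇔Lower⊎Upper x≤k _))
      (Equivalence.from restrictedSumset-Lower⊎Upper (u , t , u+t≡h , s₁ ,
         restrictedSumset-Interval⁺ u u≤x s₁∈ , restrictedSumset-Interval⁺ t x+2+t≤k+2 s-s₁∈))
    where
    u = h ℕ.∸ t
    u+t≡h : u ℕ.+ t ≡ h
    u+t≡h = ℕP.m∸n+n≡m t≤h
    u≤x : 0ℤ + + u ≤ + x - + 1 + + 1
    u≤x = subst (+ u ≤_) (sym (i-j+j≡i (+ x) (+ 1)))
                (+≤+ (ℕP.m≤n+o⇒m∸n≤o h t (subst (h ℕ.≤_) (ℕP.+-comm x t) h≤x+t)))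
    x+2+t≤k+2 : + x + + 2 + + t ≤ + k + + 1 + + 1
    x+2+t≤k+2 = +≤+ (subst₂ ℕ._≤_ (shuffle x t) (sym (ℕP.+-assoc k 1 1)) (ℕP.+-monoˡ-≤ 2 x+t≤k))
      where
      shuffle : ∀ x t → x ℕ.+ t ℕ.+ 2 ≡ x ℕ.+ 2 ℕ.+ t
      shuffle = ℕ-solve-∀
    lo₁≤hi₁ : triangular u + + u * 0ℤ ≤ triangular u + + u * (+ x - + 1 + + 1 - + u)
    lo₁≤hi₁ = ℤP.+-monoʳ-≤ (triangular u) (ℤP.*-monoˡ-≤-nonNeg (+ u) (ℤP.i≤j⇒0≤j-i u≤x))
    lo₂≤hi₂ : triangular t + + t * (+ x + + 2) ≤ triangular t + + t * (+ k + + 1 + + 1 - + t)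
    lo₂≤hi₂ = ℤP.+-monoʳ-≤ (triangular t) (ℤP.*-monoˡ-≤-nonNeg (+ t)
      (ℤP.≤-trans (ℤP.≤-reflexive (sym (i+j-j≡i (+ x + + 2) (+ t)))) (ℤP.+-monoˡ-≤ (- + t) x+2+t≤k+2)))

  -- Write h = t + 1 + u, x = u + 1 + v and k = x + t + 1 + w: u, v, w are the slacks in the
  -- admissibility of t and t + 1, and 2 - (u v + t w) is the gap between their intervals.
  step-identities : ∀ {t u v w} → suc t ℕ.+ u ≡ h → suc u ℕ.+ v ≡ x → x ℕ.+ suc t ℕ.+ w ≡ k
    → lowest (suc t) ≡ lowest t + + (v ℕ.+ t ℕ.+ 3)
    × highest (suc t) ≡ highest t + + (u ℕ.+ w ℕ.+ 3)
    × highest t + + 1 ≡ lowest (suc t) + (+ u * + v + + t * + w - + 2)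
  step-identities {t} {u} {v} {w} refl refl refl =
      lowest-step (triangular h) (+ t) (+ u) (+ v)
    , highest-step (triangular h) (+ t) (+ u) (+ v) (+ w)
    , excess (triangular h) (+ t) (+ u) (+ v) (+ w)
    where
    lowest-step : ∀ th t u v → let h = + 1 + t + u ; x = + 1 + u + v in
      th + (+ 1 + t) * (x + + 2 - h + (+ 1 + t)) ≡ th + t * (x + + 2 - h + t) + (v + t + + 3)
    lowest-step = solve-∀
    highest-step : ∀ th t u v w → let h = + 1 + t + u ; x = + 1 + u + v ; k = x + (+ 1 + t) + w in
      th + h * (x - h) + (+ 1 + t) * (k - x + h + + 2 - (+ 1 + t))
        ≡ th + h * (x - h) + t * (k - x + h + + 2 - t) + (u + w + + 3)
    highest-step = solve-∀
    excess : ∀ th t u v w → let h = + 1 + t + u ; x = + 1 + u + v ; k = x + (+ 1 + t) + w in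
      th + h * (x - h) + t * (k - x + h + + 2 - t) + + 1
        ≡ th + (+ 1 + t) * (x + + 2 - h + (+ 1 + t)) + (u * v + t * w - + 2)
    excess = solve-∀

  chain-step : 3 ℕ.≤ h → h ℕ.+ 3 ℕ.≤ k → ∀ {t} → Admissible t → Admissible (suc t)
    → lowest t ≤ lowest (suc t) × highest t ≤ highest (suc t)
      × (¬ (t ≡ 0 × x ≡ h) → ¬ (suc t ≡ h × x ℕ.+ h ≡ k) → lowest (suc t) ≤ highest t + + 1)
  chain-step 3≤h h+3≤k {t} (h≤x+t , _ , _) (_ , 1+t≤h , x+1+t≤k)
    with u , refl ← ℕP.m≤n⇒∃[o]m+o≡n 1+t≤h
    with v , refl ← ℕP.m≤n⇒∃[o]m+o≡n
                      (ℕP.+-cancelʳ-≤ t (suc u) x (subst (ℕ._≤ x ℕ.+ t) (cong suc (ℕP.+-comm t u)) h≤x+t))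
    with w , refl ← ℕP.m≤n⇒∃[o]m+o≡n x+1+t≤k
    with lowest-step , highest-step , excess ← step-identities {t} {u} {v} {w} refl refl refl =
    j≡i+n⇒i≤j _ lowest-step , j≡i+n⇒i≤j _ highest-step , adjacent
    where
    2≤u+t : 2 ℕ.≤ u ℕ.+ t
    2≤u+t = subst (2 ℕ.≤_) (ℕP.+-comm t u) (ℕ.s≤s⁻¹ 3≤h)
    2≤v+w : 2 ℕ.≤ v ℕ.+ w
    2≤v+w = ℕ.s≤s⁻¹ (ℕP.+-cancelˡ-≤ h 3 (suc (v ℕ.+ w)) (subst (h ℕ.+ 3 ℕ.≤_) (regroup t u v w) h+3≤k))
      where
      regroup : ∀ t u v w → suc u ℕ.+ v ℕ.+ suc t ℕ.+ w ≡ suc t ℕ.+ u ℕ.+ suc (v ℕ.+ w)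
      regroup = ℕ-solve-∀
    adjacent : ¬ (t ≡ 0 × x ≡ h) → ¬ (suc t ≡ h × x ℕ.+ h ≡ k) → lowest (suc t) ≤ highest t + + 1
    adjacent no-gap-below no-gap-above with 2≤uv+tw u t v w 2≤u+t 2≤v+w
    ... | inj₁ (refl , refl) = ⊥-elim (no-gap-below (refl , ℕP.+-identityʳ (suc u)))
    ... | inj₂ (inj₁ (refl , refl)) =
      ⊥-elim (no-gap-above (sym (ℕP.+-identityʳ (suc t)) , sym (ℕP.+-assoc (suc v) (suc t) 0)))
    ... | inj₂ (inj₂ 2≤uv+tw) = let c , 2+c≡uv+tw = ℕP.m≤n⇒∃[o]m+o≡n 2≤uv+tw in
      j≡i+n⇒i≤j c (trans excess (cong (λ z → lowest (suc t) + z) (begin-equality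
        + u * + v + + t * + w - + 2      ≡⟨ cong₂ (λ a b → a + b - + 2) (ℤP.pos-* u v) (ℤP.pos-* t w) ⟨
        + (u ℕ.* v ℕ.+ t ℕ.* w) - + 2    ≡⟨ cong (λ z → + z - + 2) 2+c≡uv+tw ⟨
        + 2 + + c - + 2                  ≡⟨ i+j-i≡j (+ 2) (+ c) ⟩
        + c                              ∎)))

  chained : ∀ {t₀ t₁} → 3 ℕ.≤ h → h ℕ.+ 3 ℕ.≤ k → (∀ {t} → t₀ ℕ.≤ t → t ℕ.≤ t₁ → Admissible t)
          → 0 ℕ.< t₀ ⊎ x ≢ h → t₁ ℕ.< h ⊎ x ℕ.+ h ≢ k → Chained lowest highest t₀ t₁
  chained {t₀} {t₁} 3≤h h+3≤k admissible starts-late stops-early t t₀≤t 1+t≤t₁ =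
    let lo≤ , hi≤ , adjacent = chain-step 3≤h h+3≤k (admissible t₀≤t (ℕP.<⇒≤ 1+t≤t₁))
                                                    (admissible (ℕP.m≤n⇒m≤1+n t₀≤t) 1+t≤t₁) in
    lo≤ , hi≤ , adjacent no-gap-below no-gap-above
    where
    no-gap-below : ¬ (t ≡ 0 × x ≡ h)
    no-gap-below (refl , x≡h) =
      [ (λ 0<t₀ → ℕP.<-irrefl refl (ℕP.<-≤-trans 0<t₀ t₀≤t)) , (λ x≢h → x≢h x≡h) ]′ starts-late
    no-gap-above : ¬ (suc t ≡ h × x ℕ.+ h ≡ k)
    no-gap-above (1+t≡h , x+h≡k) =
      [ (λ t₁<h → ℕP.<-irrefl refl (ℕP.<-≤-trans t₁<h (subst (ℕ._≤ t₁) 1+t≡h 1+t≤t₁))) , (λ x+h≢k → x+h≢k x+h≡k) ]′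
        stops-early

  AdmissibleRange : ℕ → ℕ → Set
  AdmissibleRange t₀ t₁ = ∀ t → Admissible t ⇔ (t₀ ℕ.≤ t × t ℕ.≤ t₁)

  module _ {t₀ t₁ : ℕ} (range : AdmissibleRange t₀ t₁) (t₀≤t₁ : t₀ ℕ.≤ t₁) where

    restrictedSumset⇔InUnion : ∀ s → RestrictedSumset h (A k (+ x)) s ⇔ InUnion lowest highest t₀ t₁ s
    restrictedSumset⇔InUnion s = mk⇔
      (λ S → let t , adm , s∈ = restrictedSumset-A⇒ x≤k S ; t₀≤t , t≤t₁ = Equivalence.to (range t) adm in
             t , t₀≤t , t≤t₁ , s∈)
      (λ (t , t₀≤t , t≤t₁ , s∈) → restrictedSumset-A⇐ x≤k (t , Equivalence.from (range t) (t₀≤t , t≤t₁) , s∈))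
      where
      x≤k : x ℕ.≤ k
      x≤k = ℕP.≤-trans (ℕP.m≤m+n x t₀) (proj₂ (proj₂ (Equivalence.from (range t₀) (ℕP.≤-refl , t₀≤t₁))))

    hasCard-chain : 3 ℕ.≤ h → h ℕ.+ 3 ℕ.≤ k → 0 ℕ.< t₀ ⊎ x ≢ h → t₁ ℕ.< h ⊎ x ℕ.+ h ≢ k
                  → ∀ {n} → highest t₁ + + 1 ≡ lowest t₀ + + n → HasCard (RestrictedSumset h (A k (+ x))) n
    hasCard-chain 3≤h h+3≤k starts-late stops-early {n} count = hasCard-resp
      (λ s → ⇔.sym (⇔.trans (restrictedSumset⇔InUnion s) (⋃-chain lowest highest chain t₀≤t₁)))
      (hasCard-Interval n count)
      where
      chain = chained 3≤h h+3≤k (λ t₀≤t t≤t₁ → Equivalence.from (range _) (t₀≤t , t≤t₁)) starts-late stops-early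

  admissible-below : ∀ {d} → x ℕ.+ d ≡ h → x ℕ.+ h ℕ.≤ k → AdmissibleRange d h
  admissible-below {d} x+d≡h x+h≤k t = mk⇔
    (λ (h≤x+t , t≤h , _) → ℕP.+-cancelˡ-≤ x d t (subst (ℕ._≤ x ℕ.+ t) (sym x+d≡h) h≤x+t) , t≤h)
    (λ (d≤t , t≤h) → subst (ℕ._≤ x ℕ.+ t) x+d≡h (ℕP.+-monoʳ-≤ x d≤t) , t≤h ,
                     ℕP.≤-trans (ℕP.+-monoʳ-≤ x t≤h) x+h≤k)

  admissible-above : ∀ {c} → x ℕ.+ c ≡ k → h ℕ.≤ x → c ℕ.≤ h → AdmissibleRange 0 c
  admissible-above {c} x+c≡k h≤x c≤h t = mk⇔
    (λ (_ , _ , x+t≤k) → z≤n , ℕP.+-cancelˡ-≤ x t c (subst (x ℕ.+ t ℕ.≤_) (sym x+c≡k) x+t≤k))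
    (λ (_ , t≤c) → ℕP.≤-trans h≤x (ℕP.m≤m+n x t) , ℕP.≤-trans t≤c c≤h ,
                   subst (x ℕ.+ t ℕ.≤_) x+c≡k (ℕP.+-monoʳ-≤ x t≤c))

  admissible-all : h ℕ.≤ x → x ℕ.+ h ℕ.≤ k → AdmissibleRange 0 h
  admissible-all h≤x x+h≤k t = mk⇔
    (λ (_ , t≤h , _) → z≤n , t≤h)
    (λ (_ , t≤h) → ℕP.≤-trans h≤x (ℕP.m≤m+n x t) , t≤h , ℕP.≤-trans (ℕP.+-monoʳ-≤ x t≤h) x+h≤k)

  gap-below : x ≡ h → lowest 0 ≡ highest 0 × lowest 1 ≡ lowest 0 + + 3
  gap-below refl = point (triangular h) (+ h) (+ k) , jump (triangular h) (+ h)
    where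
    point : ∀ th h k → th + + 0 * (h + + 2 - h + + 0) ≡ th + h * (h - h) + + 0 * (k - h + h + + 2 - + 0)
    point = solve-∀
    jump : ∀ th h → th + + 1 * (h + + 2 - h + + 1) ≡ th + + 0 * (h + + 2 - h + + 0) + + 3
    jump = solve-∀

  gap-above : ∀ {h′} → suc h′ ≡ h → x ℕ.+ h ≡ k → lowest h ≡ highest h × lowest h ≡ highest h′ + + 3
  gap-above {h′} refl refl = point (triangular h) (+ h′) (+ x) , jump (triangular h) (+ h′) (+ x)
    where
    point : ∀ th h′ x → let h = + 1 + h′ ; k = x + h in
      th + h * (x + + 2 - h + h) ≡ th + h * (x - h) + h * (k - x + h + + 2 - h)
    point = solve-∀
    jump : ∀ th h′ x → let h = + 1 + h′ ; k = x + h in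
      th + h * (x + + 2 - h + h) ≡ th + h * (x - h) + h′ * (k - x + h + + 2 - h′) + + 3
    jump = solve-∀

-- The four cases

card-x<h : ∀ h k x → 3 ℕ.≤ h → 3 ℕ.* h ℕ.+ 3 ℕ.≤ k → x ℕ.< h
  → Σ ℕ λ n → HasCard (RestrictedSumset h (A k (+ x))) n × + n ≡ + h * + k - + h * + h + + 2 * + x + + 1
card-x<h h k x 3≤h 3h+3≤k x<h
  with d , refl ← ℕP.m≤n⇒∃[o]m+o≡n (ℕP.<⇒≤ x<h)
     | e , refl ← ℕP.m≤n⇒∃[o]m+o≡n (ℕP.≤-trans (ℕP.m≤m+n h 3) (h+3≤k h 3h+3≤k)) =
  n , hasCard-chain h k x (admissible-below h k x {d} refl (ℕP.<⇒≤ x+h<k)) (ℕP.m≤n+m d x) 3≤h (h+3≤k h 3h+3≤k)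
                    (inj₂ (ℕP.<⇒≢ x<h)) (inj₂ (ℕP.<⇒≢ x+h<k)) count
    , trans n≡ (formula (+ h) (+ e) (+ x))
  where
  n = h ℕ.* e ℕ.+ 2 ℕ.* x ℕ.+ 1
  n≡ : + n ≡ + h * + e + + 2 * + x + + 1
  n≡ = cong₂ (λ a b → a + b + + 1) (ℤP.pos-* h e) (ℤP.pos-* 2 x)
  x+h<k : x ℕ.+ h ℕ.< k
  x+h<k = ℕP.<-trans (ℕP.+-monoˡ-< h x<h) (h+h<k h 3h+3≤k)
  count : highest h k x h + + 1 ≡ lowest h k x d + + n
  count = trans (identity (triangular h) (+ x) (+ d) (+ e)) (cong (λ z → lowest h k x d + z) (sym n≡))
    where
    identity : ∀ th x d e → let h = x + d ; k = x + d + e in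
      th + h * (x - h) + h * (k - x + h + + 2 - h) + + 1 ≡ th + d * (x + + 2 - h + d) + (h * e + + 2 * x + + 1)
    identity = solve-∀
  formula : ∀ h e x → h * e + + 2 * x + + 1 ≡ h * (h + e) - h * h + + 2 * x + + 1
  formula = solve-∀

card-k<x+h : ∀ h k x → 3 ℕ.≤ h → 3 ℕ.* h ℕ.+ 3 ℕ.≤ k → k ℕ.< x ℕ.+ h → x ℕ.≤ k
  → Σ ℕ λ n → HasCard (RestrictedSumset h (A k (+ x))) n × + n ≡ (+ h + + 2) * + k - + h * + h - + 2 * + x + + 1
card-k<x+h h k x 3≤h 3h+3≤k k<x+h x≤k
  with h<x ← ℕP.+-cancelʳ-< h h x (ℕP.<-trans (h+h<k h 3h+3≤k) k<x+h)
  with c , refl ← ℕP.m≤n⇒∃[o]m+o≡n x≤k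
  with f , refl ← ℕP.m≤n⇒∃[o]m+o≡n (ℕP.<⇒≤ h<x) =
  n , hasCard-chain h k x (admissible-above h k x {c} refl (ℕP.<⇒≤ h<x) (ℕP.<⇒≤ c<h)) z≤n 3≤h (h+3≤k h 3h+3≤k)
                    (inj₂ (ℕP.<⇒≢ h<x ∘ sym)) (inj₁ c<h) count
    , trans n≡ (formula (+ h) (+ f) (+ c))
  where
  c<h : c ℕ.< h
  c<h = ℕP.+-cancelˡ-< x c h k<x+h
  n = h ℕ.* f ℕ.+ h ℕ.* c ℕ.+ 2 ℕ.* c ℕ.+ 1
  n≡ : + n ≡ + h * + f + + h * + c + + 2 * + c + + 1
  n≡ = cong₂ (λ a b → a + b + + 1) (cong₂ _+_ (ℤP.pos-* h f) (ℤP.pos-* h c)) (ℤP.pos-* 2 c)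
  count : highest h k x c + + 1 ≡ lowest h k x 0 + + n
  count = trans (identity (triangular h) (+ h) (+ f) (+ c)) (cong (λ z → lowest h k x 0 + z) (sym n≡))
    where
    identity : ∀ th h f c → let x = h + f ; k = h + f + c in
      th + h * (x - h) + c * (k - x + h + + 2 - c) + + 1
        ≡ th + + 0 * (x + + 2 - h + + 0) + (h * f + h * c + + 2 * c + + 1)
    identity = solve-∀
  formula : ∀ h f c → h * f + h * c + + 2 * c + + 1 ≡ (h + + 2) * (h + f + c) - h * h - + 2 * (h + f) + + 1
  formula = solve-∀

card-h<x<k-h : ∀ h k x → 3 ℕ.≤ h → 3 ℕ.* h ℕ.+ 3 ℕ.≤ k → h ℕ.< x → x ℕ.+ h ℕ.< k
  → Σ ℕ λ n → HasCard (RestrictedSumset h (A k (+ x))) n × + n ≡ + h * + k - + h * + h + + 2 * + h + + 1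
card-h<x<k-h h k x 3≤h 3h+3≤k h<x x+h<k
  with e , refl ← ℕP.m≤n⇒∃[o]m+o≡n (ℕP.≤-trans (ℕP.m≤n+m h x) (ℕP.<⇒≤ x+h<k)) =
  n , hasCard-chain h k x (admissible-all h k x (ℕP.<⇒≤ h<x) (ℕP.<⇒≤ x+h<k)) z≤n 3≤h (h+3≤k h 3h+3≤k)
                    (inj₂ (ℕP.<⇒≢ h<x ∘ sym)) (inj₂ (ℕP.<⇒≢ x+h<k)) count
    , trans n≡ (formula (+ h) (+ e))
  where
  n = h ℕ.* e ℕ.+ 2 ℕ.* h ℕ.+ 1
  n≡ : + n ≡ + h * + e + + 2 * + h + + 1
  n≡ = cong₂ (λ a b → a + b + + 1) (ℤP.pos-* h e) (ℤP.pos-* 2 h)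
  count : highest h k x h + + 1 ≡ lowest h k x 0 + + n
  count = trans (identity (triangular h) (+ h) (+ x) (+ e)) (cong (λ z → lowest h k x 0 + z) (sym n≡))
    where
    identity : ∀ th h x e → let k = h + e in
      th + h * (x - h) + h * (k - x + h + + 2 - h) + + 1 ≡ th + + 0 * (x + + 2 - h + + 0) + (h * e + + 2 * h + + 1)
    identity = solve-∀
  formula : ∀ h e → h * e + + 2 * h + + 1 ≡ h * (h + e) - h * h + + 2 * h + + 1
  formula = solve-∀

card-x≡h : ∀ h k x → 3 ℕ.≤ h → 3 ℕ.* h ℕ.+ 3 ℕ.≤ k → x ≡ h
  → Σ ℕ λ n → HasCard (RestrictedSumset h (A k (+ x))) n × + n ≡ + h * + k - + h * + h + + 2 * + h - + 1
card-x≡h h k .h 3≤h 3h+3≤k refl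
  with h′ , refl ← ℕP.m≤n⇒∃[o]m+o≡n (ℕP.≤-trans (s≤s z≤n) 3≤h)
  with e , refl ← ℕP.m≤n⇒∃[o]m+o≡n (ℕP.≤-trans (ℕP.m≤m+n h 3) (h+3≤k h 3h+3≤k)) =
  suc n , hasCard-resp (λ s → ⇔.sym (equivalence s)) (hasCard-insert lo₀∉ (hasCard-Interval n count))
        , trans (cong (λ z → + 1 + z) n≡) (formula (+ h′) (+ e))
  where
  lo = lowest h k h
  hi = highest h k h
  point : lo 0 ≡ hi 0
  point = proj₁ (gap-below h k h refl)
  jump : lo 1 ≡ lo 0 + + 3
  jump = proj₂ (gap-below h k h refl)
  range : AdmissibleRange h k h 0 h
  range = admissible-all h k h ℕP.≤-refl (ℕP.<⇒≤ (h+h<k h 3h+3≤k))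
  chain : Chained lo hi 1 h
  chain = chained h k h 3≤h (h+3≤k h 3h+3≤k) (λ _ t≤h → Equivalence.from (range _) (z≤n , t≤h))
                  (inj₁ (s≤s z≤n)) (inj₂ (ℕP.<⇒≢ (h+h<k h 3h+3≤k)))
  equivalence : ∀ s → RestrictedSumset h (A k (+ h)) s ⇔ (s ≡ lo 0 ⊎ Interval (lo 1) (hi h) s)
  equivalence s = ⇔.trans (restrictedSumset⇔InUnion h k h range z≤n s)
                 (⇔.trans (InUnion-split-first z≤n) (Interval-point point ⊎-⇔ ⋃-chain lo hi chain (s≤s z≤n)))
  lo₀∉ : ¬ Interval (lo 1) (hi h) (lo 0)
  lo₀∉ (lo₁≤lo₀ , _) = ℤP.<⇒≱ (j≡i+1+n⇒i<j 2 jump) lo₁≤lo₀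
  n = h ℕ.* e ℕ.+ 2 ℕ.* h′
  n≡ : + n ≡ + h * + e + + 2 * + h′
  n≡ = cong₂ _+_ (ℤP.pos-* h e) (ℤP.pos-* 2 h′)
  count : hi h + + 1 ≡ lo 1 + + n
  count = trans (identity (triangular h) (+ h′) (+ e)) (cong (λ z → lo 1 + z) (sym n≡))
    where
    identity : ∀ th h′ e → let h = + 1 + h′ ; k = h + e in
      th + h * (h - h) + h * (k - h + h + + 2 - h) + + 1 ≡ th + + 1 * (h + + 2 - h + + 1) + (h * e + + 2 * h′)
    identity = solve-∀
  formula : ∀ h′ e → let h = + 1 + h′ in + 1 + (h * e + + 2 * h′) ≡ h * (h + e) - h * h + + 2 * h - + 1
  formula = solve-∀

card-x+h≡k : ∀ h k x → 3 ℕ.≤ h → 3 ℕ.* h ℕ.+ 3 ℕ.≤ k → x ℕ.+ h ≡ k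
  → Σ ℕ λ n → HasCard (RestrictedSumset h (A k (+ x))) n × + n ≡ + h * + k - + h * + h + + 2 * + h - + 1
card-x+h≡k h .(x ℕ.+ h) x 3≤h 3h+3≤k refl
  with h<x ← ℕP.+-cancelʳ-< h h x (h+h<k h 3h+3≤k)
  with h′ , refl ← ℕP.m≤n⇒∃[o]m+o≡n (ℕP.≤-trans (s≤s z≤n) 3≤h) =
  suc n , hasCard-resp (λ s → ⇔.sym (equivalence s)) (hasCard-insert loₕ∉ (hasCard-Interval n count))
        , trans (cong (λ z → + 1 + z) n≡) (formula (+ h′) (+ x))
  where
  k = x ℕ.+ h
  lo = lowest h k x
  hi = highest h k x
  point : lo h ≡ hi h
  point = proj₁ (gap-above h k x refl refl)
  jump : lo h ≡ hi h′ + + 3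
  jump = proj₂ (gap-above h k x refl refl)
  range : AdmissibleRange h k x 0 h
  range = admissible-all h k x (ℕP.<⇒≤ h<x) ℕP.≤-refl
  chain : Chained lo hi 0 h′
  chain = chained h k x 3≤h (h+3≤k h 3h+3≤k) (λ _ t≤h′ → Equivalence.from (range _) (z≤n , ℕP.m≤n⇒m≤1+n t≤h′))
                  (inj₂ (ℕP.<⇒≢ h<x ∘ sym)) (inj₁ ℕP.≤-refl)
  equivalence : ∀ s → RestrictedSumset h (A k (+ x)) s ⇔ (s ≡ lo h ⊎ Interval (lo 0) (hi h′) s)
  equivalence s = ⇔.trans (restrictedSumset⇔InUnion h k x range z≤n s)
                 (⇔.trans (InUnion-split-last z≤n)
                 (⇔.trans (⋃-chain lo hi chain z≤n ⊎-⇔ Interval-point point) (mk⇔ swap swap)))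
  loₕ∉ : ¬ Interval (lo 0) (hi h′) (lo h)
  loₕ∉ (_ , loₕ≤hiₕ′) = ℤP.<⇒≱ (j≡i+1+n⇒i<j 2 jump) loₕ≤hiₕ′
  n = h ℕ.* x ℕ.+ 2 ℕ.* h′
  n≡ : + n ≡ + h * + x + + 2 * + h′
  n≡ = cong₂ _+_ (ℤP.pos-* h x) (ℤP.pos-* 2 h′)
  count : hi h′ + + 1 ≡ lo 0 + + n
  count = trans (identity (triangular h) (+ h′) (+ x)) (cong (λ z → lo 0 + z) (sym n≡))
    where
    identity : ∀ th h′ x → let h = + 1 + h′ ; k = x + h in
      th + h * (x - h) + h′ * (k - x + h + + 2 - h′) + + 1 ≡ th + + 0 * (x + + 2 - h + + 0) + (h * x + + 2 * h′)
    identity = solve-∀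
  formula : ∀ h′ x → let h = + 1 + h′ in + 1 + (h * x + + 2 * h′) ≡ h * (x + h) - h * h + + 2 * h - + 1
  formula = solve-∀

proposition2p2 : (h k : ℕ) (x : ℤ) → + 3 ≤ + h → + 3 * + h + + 3 ≤ + k
    → + 1 ≤ x → x ≤ + k - + 1
    → ((+ 1 ≤ x → x ≤ + h - + 1
         → Σ ℕ λ n → HasCard (RestrictedSumset h (A k x)) n
           × + n ≡ + h * + k - + h * + h + + 2 * x + + 1)
     × (+ k - + h + + 1 ≤ x → x ≤ + k - + 1
         → Σ ℕ λ n → HasCard (RestrictedSumset h (A k x)) n
           × + n ≡ (+ h + + 2) * + k - + h * + h - + 2 * x + + 1)
     × ((x ≡ + h) ⊎ (x ≡ + k - + h)
         → Σ ℕ λ n → HasCard (RestrictedSumset h (A k x)) n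
           × + n ≡ + h * + k - + h * + h + + 2 * + h - + 1)
     × (+ h + + 1 ≤ x → x ≤ + k - + h - + 1
         → Σ ℕ λ n → HasCard (RestrictedSumset h (A k x)) n
           × + n ≡ + h * + k - + h * + h + + 2 * + h + + 1))
proposition2p2 h k -[1+ _ ] _   _      ()  _
proposition2p2 h k (+ x)    3≤h 3h+3≤k _   _ =
    (λ _ x≤h-1 → card-x<h h k x h≥3 k≥3h+3 (ℤP.drop‿+<+ (i≤j-1⇒i<j x≤h-1)))
  , (λ k-h+1≤x x≤k-1 → card-k<x+h h k x h≥3 k≥3h+3
       (ℤP.drop‿+<+ (i-k+1≤j⇒i<j+k {k = + h} k-h+1≤x)) (ℕP.<⇒≤ (ℤP.drop‿+<+ (i≤j-1⇒i<j x≤k-1))))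
  , [ (λ x≡h → card-x≡h h k x h≥3 k≥3h+3 (ℤP.+-injective x≡h))
    , (λ x≡k-h → card-x+h≡k h k x h≥3 k≥3h+3
                   (ℤP.+-injective (trans (cong (_+ + h) x≡k-h) (i-j+j≡i (+ k) (+ h))))) ]′
  , (λ h+1≤x x≤k-h-1 → card-h<x<k-h h k x h≥3 k≥3h+3
       (subst (ℕ._≤ x) (ℕP.+-comm h 1) (ℤP.drop‿+≤+ h+1≤x))
       (ℤP.drop‿+<+ (i<j-k⇒i+k<j {k = + h} (i≤j-1⇒i<j x≤k-h-1))))
  where
  h≥3 : 3 ℕ.≤ h
  h≥3 = ℤP.drop‿+≤+ 3≤h
  k≥3h+3 : 3 ℕ.* h ℕ.+ 3 ℕ.≤ k
  k≥3h+3 = ℤP.drop‿+≤+ (subst (λ z → z + + 3 ≤ + k) (sym (ℤP.pos-* 3 h)) 3h+3≤k)
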